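{- Let $w=11122322221$, $w^*=111223^*22221$ and $$j_1=m\left(\overline{21}\,1232321212112221\,w\,w\,w^*\,w\,11121\,\overline{12}\right).$$ Suppose $B\in\{1,2,3\}^{\mathbb{Z}}$ satisfies $B=22221\,w^*\,11122$ and $m(B)<j_1$. Then $B=2221\,w\,w^*\,\overline{w}$.
   Context: For a bi-infinite sequence $B=(b_n)_{n\in\mathbb{Z}}$ of positive integers, $\lambda_k(B)=[b_k;b_{k+1},\dots]+[0;b_{k-1},b_{k-2},\dots]$ and $m(B)=\sup_k\lambda_k(B)$. For a finite word $u=u_{ -p}\dots u_0^*\dots u_q$ with one starred letter, "$B=u$" means $(b_{ -p},\dots,b_q)=(u_{ -p},\dots,u_q)$. An overline at the right end of an expression means the word is repeated infinitely to the right (so "$B=2221ww^*\overline{w}$" prescribes all coordinates from the first letter of $2221$ onward); at the left end, repeated infinitely to the left. The starred letter is at position $0$. -}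

module Defs where

open import Data.Nat as ℕ using (ℕ; zero; suc)
open import Data.Integer as ℤ using (ℤ; +_; -[1+_])
open import Data.List using (List; []; _∷_; _++_; map; upTo; length)
open import Data.Product using (_×_; _,_; proj₁; proj₂; Σ; ∃-syntax)
open import Relation.Binary.PropositionalEquality using (_≡_)
open import Data.Rational.Unnormalised as ℚ using (ℚᵘ; mkℚᵘ)
open import Data.Nat.DivMod using (_%_)
import Data.Bool

Seq : Set
Seq = ℤ → ℕ

-- letter with default 0 outside the word
nth : List ℕ → ℕ → ℕ
nth []       _       = 0
nth (x ∷ xs) zero    = x
nth (x ∷ xs) (suc n) = nth xs n

-- finite continued fraction [a; a₁, …, aₙ] as (numerator , denominator)
cfND : ℕ → List ℕ → ℕ × ℕ
cfND a []       = a , 1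
cfND a (b ∷ bs) = let r = cfND b bs in a ℕ.* proj₁ r ℕ.+ proj₂ r , proj₁ r

-- as an (unnormalised) rational; the denominator is ≥ 1 whenever all
-- partial quotients after the first are positive (always the case here)
toQ : ℕ × ℕ → ℚᵘ
toQ (p , q) = mkℚᵘ (+ p) (q ℕ.∸ 1)

-- L B k n = [b_k; b_{k+1},…,b_{k+2n}] + [0; b_{k-1},…,b_{k-2n}]
-- (even-depth truncations, which are lower bounds increasing in n to the
-- two continued fractions; hence λ_k(B) = sup_n L B k n)
L : Seq → ℤ → ℕ → ℚᵘ
L B k n =
  toQ (cfND (B k) (map (λ i → B (k ℤ.+ + suc i)) (upTo (2 ℕ.* n))))
  ℚ.+ toQ (cfND 0 (map (λ i → B (k ℤ.- + suc i)) (upTo (2 ℕ.* n))))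

-- m(B) ≤ q  (m(B) = sup_k λ_k(B) = sup_{k,n} L B k n)
mLe : Seq → ℚᵘ → Set
mLe B q = ∀ k n → L B k n ℚ.≤ q

mGt : Seq → ℚᵘ → Set
mGt B q = ∃[ k ] ∃[ n ] q ℚ.< L B k n

-- m(B) < m(C)  iff some rational lies in between
mLt : Seq → Seq → Set
mLt B C = Σ ℚᵘ λ q → mLe B q × mGt C q

-- "B = u" with the first letter of u at position s
MatchesAt : Seq → ℤ → List ℕ → Set
MatchesAt B s u = ∀ t → t ℕ.< length u → B (s ℤ.+ + t) ≡ nth u t

Alphabet123 : Seq → Set
Alphabet123 B = ∀ i → 1 ℕ.≤ B i × B i ℕ.≤ 3

-- w = 11122322221 (the star w* is the letter 3, index 5 of w)
w : List ℕ
w = 1 ∷ 1 ∷ 1 ∷ 2 ∷ 2 ∷ 3 ∷ 2 ∷ 2 ∷ 2 ∷ 2 ∷ 1 ∷ []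

u1232321212112221 : List ℕ
u1232321212112221 = 1 ∷ 2 ∷ 3 ∷ 2 ∷ 3 ∷ 2 ∷ 1 ∷ 2 ∷ 1 ∷ 2 ∷ 1 ∷ 1 ∷ 2 ∷ 2 ∷ 2 ∷ 1 ∷ []

u11121 : List ℕ
u11121 = 1 ∷ 1 ∷ 1 ∷ 2 ∷ 1 ∷ []

u22221 : List ℕ
u22221 = 2 ∷ 2 ∷ 2 ∷ 2 ∷ 1 ∷ []

u11122 : List ℕ
u11122 = 1 ∷ 1 ∷ 1 ∷ 2 ∷ 2 ∷ []

u2221 : List ℕ
u2221 = 2 ∷ 2 ∷ 2 ∷ 1 ∷ []

-- finite middle part of the j₁ sequence, starting at position -43:
-- 1232321212112221 w w w* w 11121  (w* occupies positions -5 … 5)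
j1mid : List ℕ
j1mid = u1232321212112221 ++ w ++ w ++ w ++ w ++ u11121

-- the sequence  \overline{21} 1232321212112221 w w w* w 11121 \overline{12}
-- position -44 - s (s ≥ 0) : 1 if s even, 2 if s odd  (…2121 to the left)
-- position  22 + s (s ≥ 0) : 1 if s even, 2 if s odd  (1212… to the right)
altern : ℕ → ℕ
altern s with s % 2
... | zero = 1
... | suc _ = 2

j1seq : Seq
j1seq i with i ℤ.+ + 43
... | -[1+ s ] = altern s
... | + t with t ℕ.<ᵇ 65
...   | Data.Bool.true  = nth j1mid t
...   | Data.Bool.false = altern (t ℕ.∸ 65)

-- The rationals L B k n are the even truncations of λₖ(B), so m(B) < m(j1) yields a rational q
-- bounding every L B k n with q < L j1 k₀ n₀ ≤ J1: all L B k n lie below J1.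
-- A continued fraction [a; p, ys] with positive tail ys lies between [a; p] and [a; p, 1], so the
-- letters of B known around k bound L B k n from below. A letter of B is forced when every other
-- letter drives some L B k n up to J1, possibly after further case splits; these refutation trees
-- are checked by evaluation. From 22221 w* 11122 they force 21 w w* 11122 and then the next copy
-- of w, except at position 21, where only 3 is excluded. A 1 there would make B agree with j1 on
-- [-18, 21]; beyond that B cannot lose against j1 in the alternating lexicographic order (near 0
-- by refutations, further out because 3121 and 1213 are forbidden and j1 alternates 1, 2), so
-- λ₀(B) ≥ λ₀(j1) = m(j1), which is absurd. Hence the window 21 w w* 11122 reappears 11 positions
-- further, and induction gives the periodic tail.

module Submission where

open import Defs

module _ where

  open import Data.Bool using (Bool; true; false; not; T; if_then_else_)
  open import Data.Empty using (⊥; ⊥-elim)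
  open import Data.Integer as ℤ using (ℤ; +_; -[1+_])
  import Data.Integer.Properties as ℤP
  open import Algebra.Properties.CommutativeSemigroup ℤP.+-commutativeSemigroup using (xy∙z≈xz∙y)
  open import Data.List using (List; []; _∷_; _++_; [_]; map; upTo; applyUpTo; length)
  open import Data.List.Properties using (++-identityʳ; map-++; map-∘; map-cong; map-upTo)
  open import Data.List.Relation.Unary.All as All using (All; []; _∷_)
  open import Data.List.Relation.Unary.All.Properties
    using (++⁺; ++⁻ˡ; ++⁻ʳ; map⁺; applyUpTo⁺₁; applyUpTo⁺₂; applyUpTo⁻)
  open import Data.Maybe using (Maybe; just; nothing)
  import Data.Maybe.Properties as MaybeP
  open import Data.Nat as ℕ using (ℕ; zero; suc; _+_; _*_; _∸_; _≤_; _<_; z≤n; s≤s; z<s; s<s)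
  import Data.Nat.Properties as ℕP
  open import Data.Nat.DivMod using (_%_)
  open import Data.Nat.Tactic.RingSolver using (solve-∀)
  open import Data.Product using (_×_; _,_; proj₁; proj₂; ∃-syntax)
  open import Data.Rational.Unnormalised as ℚ using (ℚᵘ; *≤*)
  import Data.Rational.Unnormalised.Properties as ℚP
  open import Data.Sum using (_⊎_; inj₁; inj₂)
  open import Data.Unit using (⊤; tt)
  open import Function using (_∘_; _$_)
  open import Relation.Binary.PropositionalEquality hiding ([_])
  open import Relation.Nullary using (¬_; Dec; yes; no)
  open import Relation.Nullary.Decidable using (True; toWitness; _×-dec_; _⊎-dec_)
  import Relation.Unary as U

  -- Continued fractions

  Frac : Set
  Frac = ℕ × ℕ

  infix 4 _≼_ _≼?_

  _≼_ : Frac → Frac → Set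
  (p , q) ≼ (p′ , q′) = p * q′ ≤ p′ * q

  _≼?_ : ∀ x y → Dec (x ≼ y)
  (p , q) ≼? (p′ , q′) = p * q′ ℕ.≤? p′ * q

  ≼-refl : ∀ {x} → x ≼ x
  ≼-refl = ℕP.≤-refl

  ≼-flip : ∀ {x y} → ¬ x ≼ y → y ≼ x
  ≼-flip = ℕP.≰⇒≥

  _⊓ᶠ_ _⊔ᶠ_ : Frac → Frac → Frac
  x ⊓ᶠ y with x ≼? y
  ... | yes _ = x
  ... | no  _ = y
  x ⊔ᶠ y with x ≼? y
  ... | yes _ = y
  ... | no  _ = x

  ⊓ᶠ-≼ : ∀ x y → x ⊓ᶠ y ≼ x × x ⊓ᶠ y ≼ y
  ⊓ᶠ-≼ x y with x ≼? y
  ... | yes x≼y = ≼-refl {x} , x≼y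
  ... | no  x⋠y = ≼-flip {x} {y} x⋠y , ≼-refl {y}

  ≼-⊔ᶠ : ∀ x y → x ≼ x ⊔ᶠ y × y ≼ x ⊔ᶠ y
  ≼-⊔ᶠ x y with x ≼? y
  ... | yes x≼y = x≼y , ≼-refl {y}
  ... | no  x⋠y = ≼-refl {x} , ≼-flip {x} {y} x⋠y

  ⊓ᶠ-pres : ∀ (P : Frac → Set) x y → P x → P y → P (x ⊓ᶠ y)
  ⊓ᶠ-pres P x y px py with x ≼? y
  ... | yes _ = px
  ... | no  _ = py

  ⊔ᶠ-pres : ∀ (P : Frac → Set) x y → P x → P y → P (x ⊔ᶠ y)
  ⊔ᶠ-pres P x y px py with x ≼? y
  ... | yes _ = py
  ... | no  _ = px

  PosDen : Frac → Set
  PosDen (_ , q) = 1 ≤ q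

  toQ-mono : ∀ {x y} → PosDen x → PosDen y → x ≼ y → toQ x ℚ.≤ toQ y
  toQ-mono {p , suc a} {p′ , suc b} _ _ x≼y =
    *≤* (subst₂ ℤ._≤_ (ℤP.pos-* p (suc b)) (ℤP.pos-* p′ (suc a)) (ℤ.+≤+ x≼y))

  Positive : List ℕ → Set
  Positive = All (1 ≤_)

  -- cfND rebuilds the tail twice in each step, so evaluating it takes exponential time;
  -- cf shares the tail and is what every decision procedure below computes.
  cfStep : ℕ → Frac → Frac
  cfStep a (p , q) = a * p + q , p

  cf : ℕ → List ℕ → Frac
  cf a []       = a , 1
  cf a (b ∷ bs) = cfStep a (cf b bs)

  cf≡cfND : ∀ a xs → cf a xs ≡ cfND a xs
  cf≡cfND a []       = refl
  cf≡cfND a (b ∷ bs) = cong (cfStep a) (cf≡cfND b bs)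

  cfND-numerator-pos : ∀ {a} xs → 1 ≤ a → Positive xs → 1 ≤ proj₁ (cfND a xs)
  cfND-numerator-pos        []       1≤a        _           = 1≤a
  cfND-numerator-pos {suc a} (b ∷ bs) (s≤s z≤n) (1≤b ∷ pos) =
    ℕP.≤-trans (cfND-numerator-pos bs 1≤b pos) (ℕP.≤-trans (ℕP.m≤n*m _ (suc a)) (ℕP.m≤m+n _ _))

  cfND-denominator-pos : ∀ a {xs} → Positive xs → PosDen (cfND a xs)
  cfND-denominator-pos a []          = s≤s z≤n
  cfND-denominator-pos a (1≤b ∷ pos) = cfND-numerator-pos _ 1≤b pos

  record Möbius : Set where
    constructor möbius
    field p p′ q q′ : ℕ

  infixr 5 _·_
  _·_ : Möbius → Frac → Frac
  möbius p p′ q q′ · (r , s) = p * r + p′ * s , q * r + q′ * s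

  stepMöbius : ℕ → Möbius → Möbius
  stepMöbius a (möbius p p′ q q′) = möbius (a * p + q) (a * p′ + q′) p p′

  prefixMöbius : ℕ → List ℕ → Möbius
  prefixMöbius a []       = möbius a 1 1 0
  prefixMöbius a (b ∷ bs) = stepMöbius a (prefixMöbius b bs)

  -- the value of a tail, with the empty tail standing for ∞
  tailValue : List ℕ → Frac
  tailValue []       = 1 , 0
  tailValue (y ∷ ys) = cfND y ys

  cfStep-· : ∀ a M t → cfStep a (M · t) ≡ stepMöbius a M · t
  cfStep-· a (möbius p p′ q q′) (r , s) = cong₂ _,_ (lemma a p p′ q q′ r s) refl
    where
    lemma : ∀ a p p′ q q′ r s →
      a * (p * r + p′ * s) + (q * r + q′ * s) ≡ (a * p + q) * r + (a * p′ + q′) * s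
    lemma = solve-∀

  cfND-++ : ∀ a p ys → cfND a (p ++ ys) ≡ prefixMöbius a p · tailValue ys
  cfND-++ a []      []       = cong₂ _,_ (unit a) refl
    where
    unit : ∀ a → a ≡ a * 1 + 1 * 0
    unit = solve-∀
  cfND-++ a []      (y ∷ ys) = cong₂ _,_ (num a _ _) (den _ (proj₂ (cfND y ys)))
    where
    num : ∀ a r s → a * r + s ≡ a * r + 1 * s
    num = solve-∀
    den : ∀ r s → r ≡ 1 * r + 0 * s
    den = solve-∀
  cfND-++ a (b ∷ p) ys       =
    trans (cong (cfStep a) (cfND-++ b p ys)) (cfStep-· a (prefixMöbius b p) (tailValue ys))

  tailValue-≥1 : ∀ {ys} → Positive ys → proj₂ (tailValue ys) ≤ proj₁ (tailValue ys)
  tailValue-≥1 []                  = z≤n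
  tailValue-≥1 (1≤y ∷ [])          = 1≤y
  tailValue-≥1 (s≤s z≤n ∷ _ ∷ _)   = ℕP.≤-trans (ℕP.m≤m+n _ _) (ℕP.m≤m+n _ _)

  cone : ℕ → Frac → ℕ → Frac → Frac
  cone e (x , x′) s (y , y′) = e * x + s * y , e * x′ + s * y′

  ≼-cone : ∀ {c x y} e s → c ≼ x → c ≼ y → c ≼ cone e x s y
  ≼-cone {c , c′} {x , x′} {y , y′} e s c≼x c≼y = begin
    c * (e * x′ + s * y′)             ≡⟨ expandˡ c e x′ s y′ ⟩
    e * (c * x′) + s * (c * y′)       ≤⟨ ℕP.+-mono-≤ (ℕP.*-monoʳ-≤ e c≼x) (ℕP.*-monoʳ-≤ s c≼y) ⟩
    e * (x * c′) + s * (y * c′)       ≡⟨ expandʳ c′ e x s y ⟩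
    (e * x + s * y) * c′              ∎
    where
    open ℕP.≤-Reasoning
    expandˡ : ∀ c e x s y → c * (e * x + s * y) ≡ e * (c * x) + s * (c * y)
    expandˡ = solve-∀
    expandʳ : ∀ c e x s y → e * (x * c) + s * (y * c) ≡ (e * x + s * y) * c
    expandʳ = solve-∀

  cone-≼ : ∀ {c x y} e s → x ≼ c → y ≼ c → cone e x s y ≼ c
  cone-≼ {c , c′} {x , x′} {y , y′} e s x≼c y≼c = begin
    (e * x + s * y) * c′              ≡⟨ expand c′ e x s y ⟩
    e * (x * c′) + s * (y * c′)       ≤⟨ ℕP.+-mono-≤ (ℕP.*-monoʳ-≤ e x≼c) (ℕP.*-monoʳ-≤ s y≼c) ⟩
    e * (c * x′) + s * (c * y′)       ≡⟨ collect c e x′ s y′ ⟩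
    c * (e * x′ + s * y′)             ∎
    where
    open ℕP.≤-Reasoning
    expand : ∀ c e x s y → (e * x + s * y) * c ≡ e * (x * c) + s * (y * c)
    expand = solve-∀
    collect : ∀ c e x s y → e * (c * x) + s * (c * y) ≡ c * (e * x + s * y)
    collect = solve-∀

  -- A Möbius map is linear, and (r , s) = (r ∸ s) · (1 , 0) + s · (1 , 1) when s ≤ r.
  ·-cone : ∀ M {r s} → s ≤ r → M · (r , s) ≡ cone (r ∸ s) (M · (1 , 0)) s (M · (1 , 1))
  ·-cone (möbius p p′ q q′) {r} {s} s≤r = begin
    M · (r , s)                       ≡⟨ cong (λ r → M · (r , s)) (sym (ℕP.m∸n+n≡m s≤r)) ⟩
    M · (r ∸ s + s , s)               ≡⟨ cong₂ _,_ (split p p′ (r ∸ s) s) (split q q′ (r ∸ s) s) ⟩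
    cone (r ∸ s) (M · (1 , 0)) s (M · (1 , 1)) ∎
    where
    open ≡-Reasoning
    M : Möbius
    M = möbius p p′ q q′
    split : ∀ p p′ e s → p * (e + s) + p′ * s ≡ e * (p * 1 + p′ * 0) + s * (p * 1 + p′ * 1)
    split = solve-∀

  cfND-∞-endpoint : ∀ a p → cfND a p ≡ prefixMöbius a p · (1 , 0)
  cfND-∞-endpoint a p = trans (cong (cfND a) (sym (++-identityʳ p))) (cfND-++ a p [])

  -- A positive tail has value in [1, ∞], whose ends are the tails [ 1 ] and [].
  cfND-≽-++ : ∀ {c} a p {ys} → Positive ys →
    c ≼ cfND a p → c ≼ cfND a (p ++ [ 1 ]) → c ≼ cfND a (p ++ ys)
  cfND-≽-++ {c} a p {ys} pos c≼∞ c≼1 =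
    subst (c ≼_) (sym (trans (cfND-++ a p ys) (·-cone M (tailValue-≥1 pos))))
      (≼-cone {c} {M · (1 , 0)} {M · (1 , 1)} (r ∸ s) s
        (subst (c ≼_) (cfND-∞-endpoint a p) c≼∞) (subst (c ≼_) (cfND-++ a p [ 1 ]) c≼1))
    where
    M : Möbius
    M = prefixMöbius a p
    r s : ℕ
    r = proj₁ (tailValue ys)
    s = proj₂ (tailValue ys)

  cfND-≼-++ : ∀ {c} a p {ys} → Positive ys →
    cfND a p ≼ c → cfND a (p ++ [ 1 ]) ≼ c → cfND a (p ++ ys) ≼ c
  cfND-≼-++ {c} a p {ys} pos ∞≼c 1≼c =
    subst (_≼ c) (sym (trans (cfND-++ a p ys) (·-cone M (tailValue-≥1 pos))))
      (cone-≼ {c} {M · (1 , 0)} {M · (1 , 1)} (r ∸ s) s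
        (subst (_≼ c) (cfND-∞-endpoint a p) ∞≼c) (subst (_≼ c) (cfND-++ a p [ 1 ]) 1≼c))
    where
    M : Möbius
    M = prefixMöbius a p
    r s : ℕ
    r = proj₁ (tailValue ys)
    s = proj₂ (tailValue ys)

  lowerEnd upperEnd : ℕ → List ℕ → Frac
  lowerEnd a p = cf a p ⊓ᶠ cf a (p ++ [ 1 ])
  upperEnd a p = cf a p ⊔ᶠ cf a (p ++ [ 1 ])

  cf-denominator-pos : ∀ a {xs} → Positive xs → PosDen (cf a xs)
  cf-denominator-pos a {xs} pos = subst PosDen (sym (cf≡cfND a xs)) (cfND-denominator-pos a pos)

  _⊑_ : {A : Set} → List A → List A → Set
  p ⊑ xs = ∃[ ys ] xs ≡ p ++ ys

  applyUpTo-⊑ : ∀ {A : Set} (f : ℕ → A) {m n} → m ≤ n → applyUpTo f m ⊑ applyUpTo f n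
  applyUpTo-⊑ f {zero}  {n}     _         = applyUpTo f n , refl
  applyUpTo-⊑ f {suc m} {suc n} (s≤s m≤n) = proj₁ rest , cong (f 0 ∷_) (proj₂ rest)
    where
    rest : applyUpTo (f ∘ suc) m ⊑ applyUpTo (f ∘ suc) n
    rest = applyUpTo-⊑ (f ∘ suc) m≤n

  map-⊑ : ∀ {A B : Set} (f : A → B) {xs ys} → xs ⊑ ys → map f xs ⊑ map f ys
  map-⊑ f {xs} (zs , refl) = map f zs , map-++ f xs zs

  Between : ℚᵘ → ℚᵘ → ℚᵘ → Set
  Between lo x hi = lo ℚ.≤ x × x ℚ.≤ hi

  Between-+ : ∀ {a x b c y d} → Between a x b → Between c y d → Between (a ℚ.+ c) (x ℚ.+ y) (b ℚ.+ d)
  Between-+ (a≤x , x≤b) (c≤y , y≤d) = ℚP.+-mono-≤ a≤x c≤y , ℚP.+-mono-≤ x≤b y≤d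

  cfND-enclosure : ∀ a {p xs} → Positive xs → p ⊑ xs →
    Between (toQ (lowerEnd a p)) (toQ (cfND a xs)) (toQ (upperEnd a p))
  cfND-enclosure a {p} pos (ys , refl) =
    toQ-mono {lowerEnd a p} (⊓ᶠ-pres PosDen (cf a p) (cf a p1) den∞ den1) den
      (cfND-≽-++ {lowerEnd a p} a p pos-ys (subst (lowerEnd a p ≼_) (cf≡cfND a p) (proj₁ below))
                                           (subst (lowerEnd a p ≼_) (cf≡cfND a p1) (proj₂ below))) ,
    toQ-mono {y = upperEnd a p} den (⊔ᶠ-pres PosDen (cf a p) (cf a p1) den∞ den1)
      (cfND-≼-++ {upperEnd a p} a p pos-ys (subst (_≼ upperEnd a p) (cf≡cfND a p) (proj₁ above))
                                           (subst (_≼ upperEnd a p) (cf≡cfND a p1) (proj₂ above)))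
    where
    p1 : List ℕ
    p1 = p ++ [ 1 ]
    pos-p : Positive p
    pos-p = ++⁻ˡ p pos
    pos-ys : Positive ys
    pos-ys = ++⁻ʳ p pos
    den : PosDen (cfND a (p ++ ys))
    den = cfND-denominator-pos a pos
    den∞ : PosDen (cf a p)
    den∞ = cf-denominator-pos a pos-p
    den1 : PosDen (cf a p1)
    den1 = cf-denominator-pos a (++⁺ pos-p (s≤s z≤n ∷ []))
    below : lowerEnd a p ≼ cf a p × lowerEnd a p ≼ cf a p1
    below = ⊓ᶠ-≼ (cf a p) (cf a p1)
    above : cf a p ≼ upperEnd a p × cf a p1 ≼ upperEnd a p
    above = ≼-⊔ᶠ (cf a p) (cf a p1)

  cfStep-antitone : ∀ a {x y} → x ≼ y → cfStep a y ≼ cfStep a x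
  cfStep-antitone a {x , x′} {y , y′} x≼y = begin
    (a * y + y′) * x      ≡⟨ expand a x y y′ ⟩
    a * y * x + x * y′    ≤⟨ ℕP.+-monoʳ-≤ (a * y * x) x≼y ⟩
    a * y * x + y * x′    ≡⟨ collect a x x′ y ⟩
    (a * x + x′) * y      ∎
    where
    open ℕP.≤-Reasoning
    expand : ∀ a x y y′ → (a * y + y′) * x ≡ a * y * x + x * y′
    expand = solve-∀
    collect : ∀ a x x′ y → a * y * x + y * x′ ≡ (a * x + x′) * y
    collect = solve-∀

  -- [x; xs] ≤ x + 1 ≤ y ≤ [y; ys]
  cfND-head-< : ∀ {x y} xs ys → Positive xs → x < y → cfND x xs ≼ cfND y ys
  cfND-head-< {x} {y} xs ys pos x<y = begin
    X * Y′              ≤⟨ ℕP.*-monoˡ-≤ Y′ (≤-1+head xs pos) ⟩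
    suc x * X′ * Y′     ≤⟨ ℕP.*-monoˡ-≤ Y′ (ℕP.*-monoˡ-≤ X′ x<y) ⟩
    y * X′ * Y′         ≡⟨ swap y X′ Y′ ⟩
    X′ * (y * Y′)       ≤⟨ ℕP.*-monoʳ-≤ X′ (head-≤ ys) ⟩
    X′ * Y              ≡⟨ ℕP.*-comm X′ Y ⟩
    Y * X′              ∎
    where
    open ℕP.≤-Reasoning
    X X′ Y Y′ : ℕ
    X  = proj₁ (cfND x xs)
    X′ = proj₂ (cfND x xs)
    Y  = proj₁ (cfND y ys)
    Y′ = proj₂ (cfND y ys)
    swap : ∀ y x′ y′ → y * x′ * y′ ≡ x′ * (y * y′)
    swap = solve-∀
    ≤-1+head : ∀ zs → Positive zs → proj₁ (cfND x zs) ≤ suc x * proj₂ (cfND x zs)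
    ≤-1+head []       _   = ℕP.≤-trans (ℕP.n≤1+n x) (ℕP.≤-reflexive (sym (ℕP.*-identityʳ (suc x))))
    ≤-1+head (z ∷ zs) pos =
      ℕP.≤-trans (ℕP.+-monoʳ-≤ (x * Z) (tailValue-≥1 pos)) (ℕP.≤-reflexive (ℕP.+-comm (x * Z) Z))
      where
      Z : ℕ
      Z = proj₁ (cfND z zs)
    head-≤ : ∀ zs → y * proj₂ (cfND y zs) ≤ proj₁ (cfND y zs)
    head-≤ []       = ℕP.≤-reflexive (ℕP.*-identityʳ y)
    head-≤ (z ∷ zs) = ℕP.m≤m+n _ _

  alternate : ℕ → Bool → Bool
  alternate zero    b = b
  alternate (suc i) b = alternate i (not b)

  -- Prefers true x y: as a partial quotient at an even depth of the tail, x makes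
  -- [a; …] at least as large as y does; at odd depths (false) the order reverses.
  Prefers : Bool → ℕ → ℕ → Set
  Prefers true  x y = x ≤ y
  Prefers false x y = y ≤ x

  _≽[_]_ : Frac → Bool → Frac → Set
  u ≽[ true  ] v = v ≼ u
  u ≽[ false ] v = u ≼ v

  cfStep-≽ : ∀ b a {u v} → u ≽[ not b ] v → cfStep a u ≽[ b ] cfStep a v
  cfStep-≽ true  a u≼v = cfStep-antitone a u≼v
  cfStep-≽ false a v≼u = cfStep-antitone a v≼u

  AgreeBelow : (ℕ → ℕ) → (ℕ → ℕ) → ℕ → Set
  AgreeBelow x y i = ∀ j → j < i → x j ≡ y j

  cfND-by-head : ∀ b {x y} xs ys → Positive xs → Positive ys → Prefers b x y →
    (x ≡ y → cfND x xs ≽[ not b ] cfND y ys) → cfND x xs ≽[ not b ] cfND y ys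
  cfND-by-head true  xs ys pos-xs _ x≤y equal with ℕP.m≤n⇒m<n∨m≡n x≤y
  ... | inj₁ x<y = cfND-head-< xs ys pos-xs x<y
  ... | inj₂ x≡y = equal x≡y
  cfND-by-head false xs ys _ pos-ys y≤x equal with ℕP.m≤n⇒m<n∨m≡n y≤x
  ... | inj₁ y<x = cfND-head-< ys xs pos-ys y<x
  ... | inj₂ y≡x = equal (sym y≡x)

  -- The alternating lexicographic order: x beats y at the first index where they differ.
  cfND-alternating : ∀ b a (x y : ℕ → ℕ) m → (∀ i → 1 ≤ x i) → (∀ i → 1 ≤ y i) →
    (∀ i → AgreeBelow x y i → Prefers (alternate i b) (x i) (y i)) →
    cfND a (applyUpTo x m) ≽[ b ] cfND a (applyUpTo y m)
  cfND-alternating true  a x y zero _ _ _ = ≼-refl {a , 1}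
  cfND-alternating false a x y zero _ _ _ = ≼-refl {a , 1}
  cfND-alternating b a x y (suc m) pos-x pos-y prefers =
    cfStep-≽ b a (cfND-by-head b xs ys (applyUpTo⁺₂ _ m (pos-x ∘ suc)) (applyUpTo⁺₂ _ m (pos-y ∘ suc))
      (prefers 0 λ _ ()) tails)
    where
    xs ys : List ℕ
    xs = applyUpTo (x ∘ suc) m
    ys = applyUpTo (y ∘ suc) m
    tails : x 0 ≡ y 0 → cfND (x 0) xs ≽[ not b ] cfND (y 0) ys
    tails x₀≡y₀ = subst (λ c → cfND (x 0) xs ≽[ not b ] cfND c ys) x₀≡y₀
      (cfND-alternating (not b) (x 0) (x ∘ suc) (y ∘ suc) m (pos-x ∘ suc) (pos-y ∘ suc)
        λ i agree → prefers (suc i) λ { zero _ → x₀≡y₀ ; (suc j) (s≤s j<i) → agree j j<i })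

  -- Approximations of λₖ, knowledge about a sequence, and refutations

  rightPos leftPos : ℤ → ℕ → ℤ
  rightPos k i = k ℤ.+ + suc i
  leftPos  k i = k ℤ.- + suc i

  rightOf leftOf : ℤ → ℕ → List ℤ
  rightOf k m = map (rightPos k) (upTo m)
  leftOf  k m = map (leftPos k) (upTo m)

  -- [a; r] + [0; l] evaluated by end = cfND or cf, or its bounds over all positive
  -- continuations of r and l for end = lowerEnd or upperEnd
  λOf : (ℕ → List ℕ → Frac) → ℕ → List ℕ → List ℕ → ℚᵘ
  λOf end a r l = toQ (end a r) ℚ.+ toQ (end 0 l)

  L≡λOf : ∀ B k n → L B k n ≡ λOf cfND (B k) (map B (rightOf k (2 * n))) (map B (leftOf k (2 * n)))
  L≡λOf B k n = cong₂ (λ r l → λOf cfND (B k) r l) (map-∘ (upTo (2 * n))) (map-∘ (upTo (2 * n)))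

  L≡λOf-cf : ∀ B k n → L B k n ≡ λOf cf (B k) (map B (rightOf k (2 * n))) (map B (leftOf k (2 * n)))
  L≡λOf-cf B k n = trans (L≡λOf B k n)
    (sym (cong₂ (λ x y → toQ x ℚ.+ toQ y) (cf≡cfND (B k) (map B (rightOf k (2 * n))))
                                          (cf≡cfND 0 (map B (leftOf k (2 * n))))))

  PositiveSeq : Seq → Set
  PositiveSeq B = ∀ i → 1 ≤ B i

  positive-word : ∀ {B} → PositiveSeq B → ∀ is → Positive (map B is)
  positive-word pos is = map⁺ (All.universal (pos ∘ _) is)

  L-enclosure : ∀ {B} k n {r l} → PositiveSeq B →
    r ⊑ map B (rightOf k (2 * n)) → l ⊑ map B (leftOf k (2 * n)) →
    Between (λOf lowerEnd (B k) r l) (L B k n) (λOf upperEnd (B k) r l)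
  L-enclosure {B} k n pos r⊑ l⊑ rewrite L≡λOf B k n =
    Between-+ (cfND-enclosure (B k) (positive-word pos (rightOf k (2 * n))) r⊑)
              (cfND-enclosure 0     (positive-word pos (leftOf k (2 * n))) l⊑)

  Knowledge : Set
  Knowledge = List (ℤ × ℕ)

  Agrees : Seq → Knowledge → Set
  Agrees B = All λ (i , v) → B i ≡ v

  lookupK : Knowledge → ℤ → Maybe ℕ
  lookupK []            i = nothing
  lookupK ((j , v) ∷ K) i with j ℤ.≟ i
  ... | yes _ = just v
  ... | no  _ = lookupK K i

  lookupK-sound : ∀ {B K i v} → Agrees B K → lookupK K i ≡ just v → B i ≡ v
  lookupK-sound {K = (j , w) ∷ K} {i} (Bj≡w ∷ agree) eq with j ℤ.≟ i
  ... | yes refl = trans Bj≡w (MaybeP.just-injective eq)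
  ... | no  _    = lookupK-sound agree eq

  knownPrefix : Knowledge → List ℤ → List ℕ
  knownPrefix K []       = []
  knownPrefix K (i ∷ is) with lookupK K i
  ... | just v  = v ∷ knownPrefix K is
  ... | nothing = []

  knownPrefix-⊑ : ∀ {B K} → Agrees B K → ∀ is → knownPrefix K is ⊑ map B is
  knownPrefix-⊑ agree [] = [] , refl
  knownPrefix-⊑ {B} {K} agree (i ∷ is) with lookupK K i in eq
  ... | just v  = proj₁ rest , cong₂ _∷_ (lookupK-sound agree eq) (proj₂ rest)
    where
    rest : knownPrefix K is ⊑ map B is
    rest = knownPrefix-⊑ agree is
  ... | nothing = map B (i ∷ is) , refl

  _⊆ᴷ_ : Knowledge → Knowledge → Set
  K′ ⊆ᴷ K = All (λ (i , v) → lookupK K i ≡ just v) K′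

  _⊆ᴷ?_ : ∀ K′ K → Dec (K′ ⊆ᴷ K)
  K′ ⊆ᴷ? K = All.all? (λ (i , v) → MaybeP.≡-dec ℕ._≟_ (lookupK K i) (just v)) K′

  ⊆ᴷ-agrees : ∀ {B K′ K} → K′ ⊆ᴷ K → Agrees B K → Agrees B K′
  ⊆ᴷ-agrees K′⊆K agree = All.map (lookupK-sound agree) K′⊆K

  wordAt : ℤ → List ℕ → Knowledge
  wordAt s u = applyUpTo (λ t → s ℤ.+ + t , nth u t) (length u)

  matches⇒agrees : ∀ {B} s u → MatchesAt B s u → Agrees B (wordAt s u)
  matches⇒agrees s u match = applyUpTo⁺₁ _ _ (match _)

  agrees⇒matches : ∀ {B} s u → Agrees B (wordAt s u) → MatchesAt B s u
  agrees⇒matches s u agree t = applyUpTo⁻ _ _ agree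

  LBelow : Seq → ℚᵘ → Set
  LBelow B J = ∀ k n → L B k n ℚ.< J

  data Refutation : Set where
    none  : Refutation
    bound : ℤ → ℕ → Refutation
    split : ℤ → Refutation → Refutation → Refutation → Refutation

  -- bound k n: the letters known around k already force L B k n ≥ J;
  -- split p t₁ t₂ t₃: refute each of the three possible letters at p.
  Refutes : ℚᵘ → Knowledge → Refutation → Set
  Refutes J K none        = ⊥
  Refutes J K (bound k n) with lookupK K k
  ... | just a  = J ℚ.≤ λOf lowerEnd a (knownPrefix K (rightOf k (2 * n))) (knownPrefix K (leftOf k (2 * n)))
  ... | nothing = ⊥
  Refutes J K (split p t₁ t₂ t₃) =
    Refutes J ((p , 1) ∷ K) t₁ × Refutes J ((p , 2) ∷ K) t₂ × Refutes J ((p , 3) ∷ K) t₃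

  refutes? : ∀ J K t → Dec (Refutes J K t)
  refutes? J K none        = no λ ()
  refutes? J K (bound k n) with lookupK K k
  ... | just a  = J ℚP.≤? _
  ... | nothing = no λ ()
  refutes? J K (split p t₁ t₂ t₃) =
    refutes? J _ t₁ ×-dec refutes? J _ t₂ ×-dec refutes? J _ t₃

  letter∈123 : ∀ {x} → 1 ≤ x × x ≤ 3 → x ≡ 1 ⊎ x ≡ 2 ⊎ x ≡ 3
  letter∈123 {1} _ = inj₁ refl
  letter∈123 {2} _ = inj₂ (inj₁ refl)
  letter∈123 {3} _ = inj₂ (inj₂ refl)
  letter∈123 {suc (suc (suc (suc _)))} (_ , s≤s (s≤s (s≤s ())))

  refutation-sound : ∀ {J B K} t → Alphabet123 B → LBelow B J → Agrees B K → ¬ Refutes J K t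
  refutation-sound {J} {B} {K} (bound k n) alph below agree refutes with lookupK K k in eq
  ... | just a = ℚP.<⇒≱ (below k n) (ℚP.≤-trans refutes (subst (λ a → λOf lowerEnd a r l ℚ.≤ L B k n)
    (lookupK-sound agree eq) (proj₁ (L-enclosure k n (proj₁ ∘ alph) (knownPrefix-⊑ agree _) (knownPrefix-⊑ agree _)))))
    where
    r l : List ℕ
    r = knownPrefix K (rightOf k (2 * n))
    l = knownPrefix K (leftOf k (2 * n))
  refutation-sound {B = B} (split p t₁ t₂ t₃) alph below agree (r₁ , r₂ , r₃) with letter∈123 (alph p)
  ... | inj₁ Bp≡1        = refutation-sound t₁ alph below (Bp≡1 ∷ agree) r₁
  ... | inj₂ (inj₁ Bp≡2) = refutation-sound t₂ alph below (Bp≡2 ∷ agree) r₂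
  ... | inj₂ (inj₂ Bp≡3) = refutation-sound t₃ alph below (Bp≡3 ∷ agree) r₃

  Refutations : Set
  Refutations = Refutation × Refutation × Refutation

  Forces : ℚᵘ → Knowledge → ℤ → (ℕ → Set) → Refutations → Set
  Forces J K p P (t₁ , t₂ , t₃) with lookupK K p
  ... | just v  = P v
  ... | nothing = (P 1 ⊎ Refutes J ((p , 1) ∷ K) t₁) × (P 2 ⊎ Refutes J ((p , 2) ∷ K) t₂)
                  × (P 3 ⊎ Refutes J ((p , 3) ∷ K) t₃)

  forces? : ∀ J K p {P} → U.Decidable P → ∀ ts → Dec (Forces J K p P ts)
  forces? J K p P? (t₁ , t₂ , t₃) with lookupK K p
  ... | just v  = P? v
  ... | nothing =
    (P? 1 ⊎-dec refutes? J _ t₁) ×-dec (P? 2 ⊎-dec refutes? J _ t₂) ×-dec (P? 3 ⊎-dec refutes? J _ t₃)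

  satisfied-or-refuted : ∀ {J B K p c} {P : ℕ → Set} t → Alphabet123 B → LBelow B J → Agrees B K → B p ≡ c →
    P c ⊎ Refutes J ((p , c) ∷ K) t → P (B p)
  satisfied-or-refuted {P = P} t _    _     _     Bp≡c (inj₁ Pc)      = subst P (sym Bp≡c) Pc
  satisfied-or-refuted         t alph below agree Bp≡c (inj₂ refutes) =
    ⊥-elim (refutation-sound t alph below (Bp≡c ∷ agree) refutes)

  forces-sound : ∀ {J B K p P} ts → Alphabet123 B → LBelow B J → Agrees B K →
    Forces J K p P ts → P (B p)
  forces-sound {B = B} {K} {p} {P} (t₁ , t₂ , t₃) alph below agree forces with lookupK K p in eq
  ... | just v  = subst P (sym (lookupK-sound agree eq)) forces
  ... | nothing with letter∈123 (alph p) | forces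
  ...   | inj₁ Bp≡1        | o₁ , _ , _ = satisfied-or-refuted {P = P} t₁ alph below agree Bp≡1 o₁
  ...   | inj₂ (inj₁ Bp≡2) | _ , o₂ , _ = satisfied-or-refuted {P = P} t₂ alph below agree Bp≡2 o₂
  ...   | inj₂ (inj₂ Bp≡3) | _ , _ , o₃ = satisfied-or-refuted {P = P} t₃ alph below agree Bp≡3 o₃

  -- a position, the letter forced there, and the refutations of the letters 1, 2, 3
  Forcing : Set
  Forcing = ℤ × ℕ × Refutations

  learn : Knowledge → List Forcing → Knowledge
  learn K []                   = K
  learn K ((p , v , _) ∷ fs) = learn ((p , v) ∷ K) fs

  ForcesAll : ℚᵘ → Knowledge → List Forcing → Set
  ForcesAll J K []                  = ⊤
  ForcesAll J K ((p , v , ts) ∷ fs) = Forces J K p (_≡ v) ts × ForcesAll J ((p , v) ∷ K) fs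

  forcesAll? : ∀ J K fs → Dec (ForcesAll J K fs)
  forcesAll? J K []                  = yes tt
  forcesAll? J K ((p , v , ts) ∷ fs) = forces? J K p (ℕ._≟ v) ts ×-dec forcesAll? J _ fs

  forcesAll-sound : ∀ {J B K} fs → Alphabet123 B → LBelow B J → Agrees B K →
    ForcesAll J K fs → Agrees B (learn K fs)
  forcesAll-sound []                  _    _     agree _              = agree
  forcesAll-sound ((p , v , ts) ∷ fs) alph below agree (forced , rest) =
    forcesAll-sound fs alph below (forces-sound ts alph below agree forced ∷ agree) rest

  -- L C k n ≤ J for n < N by exact evaluation, and for n ≥ N through the ends of the words of length 2N
  UpperBounded : ℚᵘ → Seq → ℤ → ℕ → Set
  UpperBounded J C k N =
    (∀ {n} → n < N → λOf cf (C k) (map C (rightOf k (2 * n))) (map C (leftOf k (2 * n))) ℚ.≤ J) ×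
    λOf upperEnd (C k) (map C (rightOf k (2 * N))) (map C (leftOf k (2 * N))) ℚ.≤ J

  upperBounded? : ∀ J C k N → Dec (UpperBounded J C k N)
  upperBounded? J C k N = ℕP.allUpTo? (λ n → _ ℚP.≤? J) N ×-dec (_ ℚP.≤? J)

  upperBounded-sound : ∀ {J C k N} → PositiveSeq C → UpperBounded J C k N → ∀ n → L C k n ℚ.≤ J
  upperBounded-sound {J} {C} {k} {N} pos (exact , tail) n with n ℕ.<? N
  ... | yes n<N = subst (ℚ._≤ J) (sym (L≡λOf-cf C k n)) (exact n<N)
  ... | no  n≮N = ℚP.≤-trans (proj₂ (L-enclosure k n pos (prefix (rightPos k)) (prefix (leftPos k)))) tail
    where
    prefix : ∀ at → map C (map at (upTo (2 * N))) ⊑ map C (map at (upTo (2 * n)))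
    prefix at = map-⊑ C (map-⊑ at (applyUpTo-⊑ _ (ℕP.*-monoʳ-≤ 2 (ℕP.≮⇒≥ n≮N))))

  shift : Seq → ℤ → Seq
  shift B s i = B (i ℤ.+ s)

  L-shift : ∀ B s k n → L (shift B s) k n ≡ L B (k ℤ.+ s) n
  L-shift B s k n = cong₂ (λ r l → toQ (cfND (B (k ℤ.+ s)) r) ℚ.+ toQ (cfND 0 l))
    (map-cong (λ i → cong B (xy∙z≈xz∙y k (+ suc i) s)) (upTo (2 * n)))
    (map-cong (λ i → cong B (xy∙z≈xz∙y k (ℤ.- + suc i) s)) (upTo (2 * n)))

  matches-shift : ∀ {B s t u} → MatchesAt B (s ℤ.+ t) u → MatchesAt (shift B t) s u
  matches-shift {B} {s} {t} match i i<len = trans (cong B (sym (xy∙z≈xz∙y s t (+ i)))) (match i i<len)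

  sampleAt : Seq → (ℕ → ℤ) → ℕ → Knowledge
  sampleAt C pos m = applyUpTo (λ j → pos j , C (pos j)) m

  agreeBelow⇒agrees : ∀ {B C pos m} → AgreeBelow (B ∘ pos) (C ∘ pos) m → Agrees B (sampleAt C pos m)
  agreeBelow⇒agrees agree = applyUpTo⁺₁ _ _ (agree _)

  -- along pos, the first letter where B and C differ favours B
  Dominates : Seq → Seq → (ℕ → ℤ) → Set
  Dominates B C pos = ∀ i → AgreeBelow (B ∘ pos) (C ∘ pos) i → Prefers (alternate i true) (B (pos i)) (C (pos i))

  cfND-dominated : ∀ {B C} a pos m → PositiveSeq B → PositiveSeq C → Dominates B C pos →
    toQ (cfND a (map C (map pos (upTo m)))) ℚ.≤ toQ (cfND a (map B (map pos (upTo m))))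
  cfND-dominated {B} {C} a pos m pos-B pos-C dominates =
    subst₂ (λ u v → toQ (cfND a u) ℚ.≤ toQ (cfND a v)) (sym (word≡applyUpTo C)) (sym (word≡applyUpTo B)) $
    toQ-mono (cfND-denominator-pos a (applyUpTo⁺₂ _ m (pos-C ∘ pos)))
             (cfND-denominator-pos a (applyUpTo⁺₂ _ m (pos-B ∘ pos)))
      (cfND-alternating true a (B ∘ pos) (C ∘ pos) m (pos-B ∘ pos) (pos-C ∘ pos) dominates)
    where
    word≡applyUpTo : ∀ D → map D (map pos (upTo m)) ≡ applyUpTo (D ∘ pos) m
    word≡applyUpTo D = trans (sym (map-∘ (upTo m))) (map-upTo (D ∘ pos) m)

  L-dominated : ∀ {B C} k → PositiveSeq B → PositiveSeq C → B k ≡ C k →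
    Dominates B C (rightPos k) → Dominates B C (leftPos k) → ∀ n → L C k n ℚ.≤ L B k n
  L-dominated {B} {C} k pos-B pos-C Bk≡Ck right left n rewrite L≡λOf B k n | L≡λOf C k n | Bk≡Ck =
    ℚP.+-mono-≤ (cfND-dominated (C k) (rightPos k) (2 * n) pos-B pos-C right)
                (cfND-dominated 0 (leftPos k) (2 * n) pos-B pos-C left)

  -- Upper bounds for λₖ(j1)

  altern-pos : ∀ s → 1 ≤ altern s
  altern-pos s with s % 2
  ... | zero  = s≤s z≤n
  ... | suc _ = s≤s z≤n

  altern-≤2 : ∀ s → altern s ≤ 2
  altern-≤2 s with s % 2
  ... | zero  = s≤s z≤n
  ... | suc _ = s≤s (s≤s z≤n)

  nth-All : ∀ {P : ℕ → Set} {xs} t → All P xs → t < length xs → P (nth xs t)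
  nth-All zero    (px ∷ _)   _         = px
  nth-All (suc t) (_  ∷ pxs) (s≤s t<n) = nth-All t pxs t<n

  j1-positive : PositiveSeq j1seq
  j1-positive i with i ℤ.+ + 43
  ... | -[1+ s ] = altern-pos s
  ... | + t with t ℕ.<ᵇ 65 in lt
  ...   | true  = nth-All t (toWitness {a? = All.all? (1 ℕ.≤?_) j1mid} tt) (ℕP.<ᵇ⇒< t 65 (subst T (sym lt) _))
  ...   | false = altern-pos (t ∸ 65)

  j1-right : ∀ s → j1seq (+ (22 + s)) ≡ altern s
  j1-right s rewrite ℕP.+-comm s 43 = refl

  j1-left : ∀ s → j1seq -[1+ (43 + s) ] ≡ altern s
  j1-left s = refl

  letter∈12 : ∀ {x} → 1 ≤ x → x ≤ 2 → x ≡ 1 ⊎ x ≡ 2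
  letter∈12 {1} _ _ = inj₁ refl
  letter∈12 {2} _ _ = inj₂ refl
  letter∈12 {suc (suc (suc _))} _ (s≤s (s≤s ()))

  byEndpoints : ∀ {c} a p {ys} → Positive ys →
    True (cfND a p ≼? c) → True (cfND a (p ++ [ 1 ]) ≼? c) → cfND a (p ++ ys) ≼ c
  byEndpoints {c} a p pos ∞≼c 1≼c = cfND-≼-++ {c} a p pos (toWitness ∞≼c) (toWitness 1≼c)

  -- [a; b, c, …] ≤ [2; 1, 2, 1] = 11/4
  cfND-≼-11/4 : ∀ {a b c} ys → Positive ys → a ≡ 1 ⊎ a ≡ 2 → b ≡ 1 ⊎ b ≡ 2 → c ≡ 1 ⊎ c ≡ 2 →
    cfND a (b ∷ c ∷ ys) ≼ (11 , 4)
  cfND-≼-11/4 ys pos (inj₁ refl) (inj₁ refl) (inj₁ refl) = byEndpoints {11 , 4} 1 (1 ∷ 1 ∷ []) pos _ _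
  cfND-≼-11/4 ys pos (inj₁ refl) (inj₁ refl) (inj₂ refl) = byEndpoints {11 , 4} 1 (1 ∷ 2 ∷ []) pos _ _
  cfND-≼-11/4 ys pos (inj₁ refl) (inj₂ refl) (inj₁ refl) = byEndpoints {11 , 4} 1 (2 ∷ 1 ∷ []) pos _ _
  cfND-≼-11/4 ys pos (inj₁ refl) (inj₂ refl) (inj₂ refl) = byEndpoints {11 , 4} 1 (2 ∷ 2 ∷ []) pos _ _
  cfND-≼-11/4 ys pos (inj₂ refl) (inj₁ refl) (inj₁ refl) = byEndpoints {11 , 4} 2 (1 ∷ 1 ∷ []) pos _ _
  cfND-≼-11/4 ys pos (inj₂ refl) (inj₁ refl) (inj₂ refl) = byEndpoints {11 , 4} 2 (1 ∷ 2 ∷ []) pos _ _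
  cfND-≼-11/4 ys pos (inj₂ refl) (inj₂ refl) (inj₁ refl) = byEndpoints {11 , 4} 2 (2 ∷ 1 ∷ []) pos _ _
  cfND-≼-11/4 ys pos (inj₂ refl) (inj₂ refl) (inj₂ refl) = byEndpoints {11 , 4} 2 (2 ∷ 2 ∷ []) pos _ _

  -- [0; b, c, …] ≤ [0; 1, 2, 1] = 3/4
  cfND-≼-3/4 : ∀ {b c} ys → Positive ys → b ≡ 1 ⊎ b ≡ 2 → c ≡ 1 ⊎ c ≡ 2 → cfND 0 (b ∷ c ∷ ys) ≼ (3 , 4)
  cfND-≼-3/4 ys pos (inj₁ refl) (inj₁ refl) = byEndpoints {3 , 4} 0 (1 ∷ 1 ∷ []) pos _ _
  cfND-≼-3/4 ys pos (inj₁ refl) (inj₂ refl) = byEndpoints {3 , 4} 0 (1 ∷ 2 ∷ []) pos _ _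
  cfND-≼-3/4 ys pos (inj₂ refl) (inj₁ refl) = byEndpoints {3 , 4} 0 (2 ∷ 1 ∷ []) pos _ _
  cfND-≼-3/4 ys pos (inj₂ refl) (inj₂ refl) = byEndpoints {3 , 4} 0 (2 ∷ 2 ∷ []) pos _ _

  L-≤-7/2 : ∀ {C} k → PositiveSeq C → C k ≤ 2 → C (k ℤ.+ + 1) ≤ 2 → C (k ℤ.+ + 2) ≤ 2 →
    C (k ℤ.- + 1) ≤ 2 → C (k ℤ.- + 2) ≤ 2 → ∀ n → L C k n ℚ.≤ toQ (7 , 2)
  L-≤-7/2 {C} k pos c₀ _ _ _ _ zero =
    ℚP.≤-trans
      (ℚP.+-monoˡ-≤ (toQ (0 , 1)) (toQ-mono {C k , 1} {2 , 1} (s≤s z≤n) (s≤s z≤n) (ℕP.*-monoˡ-≤ 1 c₀)))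
      (toWitness {a? = toQ (2 , 1) ℚ.+ toQ (0 , 1) ℚP.≤? toQ (7 , 2)} tt)
  L-≤-7/2 {C} k pos c₀ c₁ c₂ c₋₁ c₋₂ (suc n) =
    subst (ℚ._≤ toQ (7 , 2)) (sym (trans (L≡λOf C k (suc n)) (cong word (ℕP.*-suc 2 n)))) (long (2 * n))
    where
    word : ℕ → ℚᵘ
    word m = λOf cfND (C k) (map C (rightOf k m)) (map C (leftOf k m))
    long : ∀ m → word (2 + m) ℚ.≤ toQ (7 , 2)
    long m = ℚP.≤-trans
      (ℚP.+-mono-≤ (toQ-mono {cfND (C k) (map C (rightOf k (2 + m)))} {11 , 4}
                     (cfND-denominator-pos (C k) (positive-word pos (rightOf k (2 + m)))) (s≤s z≤n)
                     (cfND-≼-11/4 (map C (rest (rightPos k))) (positive-word pos (rest _))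
                       (letter∈12 (pos k) c₀) (letter∈12 (pos _) c₁) (letter∈12 (pos _) c₂)))
                   (toQ-mono {cfND 0 (map C (leftOf k (2 + m)))} {3 , 4}
                     (cfND-denominator-pos 0 (positive-word pos (leftOf k (2 + m)))) (s≤s z≤n)
                     (cfND-≼-3/4 (map C (rest (leftPos k))) (positive-word pos (rest _))
                       (letter∈12 (pos _) c₋₁) (letter∈12 (pos _) c₋₂))))
      (toWitness {a? = toQ (11 , 4) ℚ.+ toQ (3 , 4) ℚP.≤? toQ (7 , 2)} tt)
      where
      rest : (ℕ → ℤ) → List ℤ
      rest at = map at (applyUpTo (λ i → suc (suc i)) m)

  j1-≤2-right : ∀ s → j1seq (+ (22 + s)) ≤ 2
  j1-≤2-right s = subst (_≤ 2) (sym (j1-right s)) (altern-≤2 s)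

  j1-≤2-left : ∀ s → j1seq -[1+ (43 + s) ] ≤ 2
  j1-≤2-left s = altern-≤2 s

  -- J1 is a rational just above m(j1) = λ₀(j1), and J0 lies strictly between λ₀(j1)
  -- and the supremum of all other λₖ(j1) (the closest competitor is λ₋₁₁).
  J1 J0 : ℚᵘ
  J1 = toQ (1628903881273 , 424849450949)
  J0 = toQ (1367517216 , 356674783)

  -- the depth N of the certificate UpperBounded J0 j1seq k N at k = 1, …, 23 and at k = -1, …, -45
  depthsRight depthsLeft : List ℕ
  depthsRight = 1 ∷ 1 ∷ 1 ∷ 1 ∷ 0 ∷ 0 ∷ 0 ∷ 0 ∷ 1 ∷ 1 ∷ 6 ∷ 1 ∷ 1 ∷ 1 ∷ 1 ∷ 0 ∷ 0 ∷ 0 ∷ 0 ∷ 1 ∷ 0 ∷ 0 ∷ 1 ∷ []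
  depthsLeft  = 1 ∷ 1 ∷ 0 ∷ 0 ∷ 0 ∷ 0 ∷ 1 ∷ 1 ∷ 1 ∷ 1 ∷ 14 ∷ 1 ∷ 1 ∷ 0 ∷ 0 ∷ 0 ∷ 0 ∷ 1 ∷ 1 ∷ 1 ∷ 1 ∷ 6 ∷ 1 ∷
                1 ∷ 0 ∷ 0 ∷ 0 ∷ 0 ∷ 1 ∷ 1 ∷ 1 ∷ 0 ∷ 0 ∷ 1 ∷ 0 ∷ 1 ∷ 0 ∷ 1 ∷ 2 ∷ 1 ∷ 2 ∷ 1 ∷ 0 ∷ 0 ∷ 1 ∷ []

  j1-near-right : ∀ {i} → i < 23 → UpperBounded J0 j1seq (+ suc i) (nth depthsRight i)
  j1-near-right = toWitness {a? = ℕP.allUpTo? (λ i → upperBounded? J0 j1seq (+ suc i) (nth depthsRight i)) 23} tt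

  j1-near-left : ∀ {i} → i < 45 → UpperBounded J0 j1seq -[1+ i ] (nth depthsLeft i)
  j1-near-left = toWitness {a? = ℕP.allUpTo? (λ i → upperBounded? J0 j1seq -[1+ i ] (nth depthsLeft i)) 45} tt

  7/2≤J0 : toQ (7 , 2) ℚ.≤ J0
  7/2≤J0 = toWitness {a? = toQ (7 , 2) ℚP.≤? J0} tt

  j1-far-right : ∀ t n → L j1seq (+ (24 + t)) n ℚ.≤ J0
  j1-far-right t n = ℚP.≤-trans (L-≤-7/2 (+ (24 + t)) j1-positive
    (j1-≤2-right (2 + t)) (j1-≤2-right (2 + (t + 1))) (j1-≤2-right (2 + (t + 2)))
    (j1-≤2-right (1 + t)) (j1-≤2-right t) n) 7/2≤J0

  j1-far-left : ∀ t n → L j1seq -[1+ (45 + t) ] n ℚ.≤ J0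
  -- the offsets 3 + (t + 0) and 3 + (t + 1) are how k - 1 and k - 2 normalise
  j1-far-left t n = ℚP.≤-trans (L-≤-7/2 -[1+ (45 + t) ] j1-positive
    (j1-≤2-left (2 + t)) (j1-≤2-left (1 + t)) (j1-≤2-left t)
    (j1-≤2-left (3 + (t + 0))) (j1-≤2-left (3 + (t + 1))) n) 7/2≤J0

  j1-≤-J0 : ∀ k n → k ≢ + 0 → L j1seq k n ℚ.≤ J0
  j1-≤-J0 (+ zero)  n k≢0 = ⊥-elim (k≢0 refl)
  j1-≤-J0 (+ suc i) n _ with i ℕ.<? 23
  ... | yes i<23 = upperBounded-sound {J0} {j1seq} {+ suc i} j1-positive (j1-near-right i<23) n
  ... | no  i≮23 =
    subst (λ i → L j1seq (+ suc i) n ℚ.≤ J0) (ℕP.m+[n∸m]≡n (ℕP.≮⇒≥ i≮23)) (j1-far-right (i ∸ 23) n)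
  j1-≤-J0 -[1+ i ]  n _ with i ℕ.<? 45
  ... | yes i<45 = upperBounded-sound {J0} {j1seq} { -[1+ i ]} j1-positive (j1-near-left i<45) n
  ... | no  i≮45 =
    subst (λ i → L j1seq -[1+ i ] n ℚ.≤ J0) (ℕP.m+[n∸m]≡n (ℕP.≮⇒≥ i≮45)) (j1-far-left (i ∸ 45) n)

  J0≤J1 : J0 ℚ.≤ J1
  J0≤J1 = toWitness {a? = J0 ℚP.≤? J1} tt

  j1-≤-J1 : ∀ k n → L j1seq k n ℚ.≤ J1
  j1-≤-J1 k n with k ℤ.≟ + 0
  ... | yes refl = upperBounded-sound {J1} {j1seq} {+ 0} j1-positive (toWitness {a? = upperBounded? J1 j1seq (+ 0) 18} tt) n
  ... | no  k≢0  = ℚP.≤-trans (j1-≤-J0 k n k≢0) J0≤J1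

  J0≤L₀ : J0 ℚ.≤ L j1seq (+ 0) 15
  J0≤L₀ = subst (J0 ℚ.≤_) (sym (L≡λOf-cf j1seq (+ 0) 15))
    (toWitness {a? = J0 ℚP.≤? λOf cf (j1seq (+ 0)) (map j1seq (rightOf (+ 0) 30)) (map j1seq (leftOf (+ 0) 30))} tt)

  j1-sup-at-0 : ∀ k n → ∃[ n′ ] L j1seq k n ℚ.≤ L j1seq (+ 0) n′
  j1-sup-at-0 k n = by-cases (k ℤ.≟ + 0)
    where
    by-cases : Dec (k ≡ + 0) → ∃[ n′ ] L j1seq k n ℚ.≤ L j1seq (+ 0) n′
    by-cases (yes refl) = n , ℚP.≤-refl {L j1seq (+ 0) n}
    by-cases (no k≢0)   = 15 , ℚP.≤-trans (j1-≤-J0 k n k≢0) J0≤L₀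

  -- Forbidden words, and the sequences that beat j1

  alphabet-shift : ∀ {B} s → Alphabet123 B → Alphabet123 (shift B s)
  alphabet-shift s alph i = alph (i ℤ.+ s)

  LBelow-shift : ∀ {B J} s → LBelow B J → LBelow (shift B s) J
  LBelow-shift {B} {J} s below k n = subst (ℚ._< J) (sym (L-shift B s k n)) (below (k ℤ.+ s) n)

  knowledge-refuted : ∀ {J B} K t → Refutes J K t → Alphabet123 B → LBelow B J → ∀ s → ¬ Agrees (shift B s) K
  knowledge-refuted K t refutes alph below s agree =
    refutation-sound t (alphabet-shift s alph) (LBelow-shift s below) agree refutes

  -- in both words the letter 3 sits at position 0
  no-3121 : ∀ {B} → Alphabet123 B → LBelow B J1 → ∀ s → ¬ Agrees (shift B s) (wordAt (+ 0) (3 ∷ 1 ∷ 2 ∷ 1 ∷ []))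
  no-3121 = knowledge-refuted K t (toWitness {a? = refutes? J1 K t} tt)
    where
    K : Knowledge
    K = wordAt (+ 0) (3 ∷ 1 ∷ 2 ∷ 1 ∷ [])
    t : Refutation
    t = split -[1+ 0 ] (bound (+ 0) 2) (bound (+ 0) 2) (bound (+ 0) 2)

  no-1213 : ∀ {B} → Alphabet123 B → LBelow B J1 → ∀ s → ¬ Agrees (shift B s) (wordAt -[1+ 2 ] (1 ∷ 2 ∷ 1 ∷ 3 ∷ []))
  no-1213 = knowledge-refuted K t (toWitness {a? = refutes? J1 K t} tt)
    where
    K : Knowledge
    K = wordAt -[1+ 2 ] (1 ∷ 2 ∷ 1 ∷ 3 ∷ [])
    t : Refutation
    t = split (+ 1) (bound (+ 0) 2) (bound (+ 0) 2) (bound (+ 0) 2)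

  -- Both alternate and altern are definitionally 2-periodic, so two base cases suffice.
  tail-parity : ∀ r → (alternate r true ≡ false × altern (3 + r) ≡ 1) ⊎
    (alternate r true ≡ true × altern (3 + r) ≡ 2 × altern (2 + r) ≡ 1 × altern (1 + r) ≡ 2 × altern r ≡ 1)
  tail-parity 0             = inj₂ (refl , refl , refl , refl , refl)
  tail-parity 1             = inj₁ (refl , refl)
  tail-parity (suc (suc r)) = tail-parity r

  -- Along a ray where y alternates 1, 2, x can beat y only through a letter 3 following 1, 2, 1.
  ray-prefers : ∀ (x y : ℕ → ℕ) c → (∀ i → 1 ≤ x i × x i ≤ 3) →
    (∀ r → alternate (c + (3 + r)) true ≡ alternate r true) → (∀ s → y (c + s) ≡ altern s) →
    (∀ r → x (c + (3 + r)) ≡ 3 → x (c + (2 + r)) ≡ 1 → x (c + (1 + r)) ≡ 2 → x (c + r) ≡ 1 → ⊥) →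
    ∀ r → AgreeBelow x y (c + (3 + r)) → Prefers (alternate (c + (3 + r)) true) (x (c + (3 + r))) (y (c + (3 + r)))
  ray-prefers x y c alph parity tail no-3 r agree rewrite parity r with tail-parity r
  ... | inj₁ (odd , y₃) rewrite odd = subst (_≤ x (c + (3 + r))) (sym (trans (tail (3 + r)) y₃)) (proj₁ (alph _))
  ... | inj₂ (even , y₃ , y₂ , y₁ , y₀) rewrite even | tail (3 + r) | y₃ with letter∈123 (alph (c + (3 + r)))
  ...   | inj₁ x≡1        = ℕP.≤-trans (ℕP.≤-reflexive x≡1) (s≤s z≤n)
  ...   | inj₂ (inj₁ x≡2) = ℕP.≤-reflexive x≡2
  ...   | inj₂ (inj₂ x≡3) =
    ⊥-elim (no-3 r x≡3 (earlier 2 (s<s (s<s z<s)) y₂) (earlier 1 (s<s z<s) y₁) (earlier 0 z<s y₀))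
    where
    earlier : ∀ k {v} → k < 3 → altern (k + r) ≡ v → x (c + (k + r)) ≡ v
    earlier k k<3 yk = trans (agree _ (ℕP.+-monoʳ-< c (ℕP.+-monoˡ-< r k<3))) (trans (tail (k + r)) yk)

  -- j1seq on [-18, 21]
  j1Core : Knowledge
  j1Core = sampleAt j1seq (λ j → -[1+ 17 ] ℤ.+ + j) 40

  prefers? : ∀ b x y → Dec (Prefers b x y)
  prefers? true  x y = x ℕ.≤? y
  prefers? false x y = y ℕ.≤? x

  RefutationTable : Set
  RefutationTable = List (ℕ × Refutations)

  tableAt : RefutationTable → ℕ → Refutations
  tableAt []             i = none , none , none
  tableAt ((j , t) ∷ ts) i = if j ℕ.≡ᵇ i then t else tableAt ts i

  -- Refutations of the letters that would make B lose against j1seq at the i-th position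
  -- to the left (right) of 0, given that B agrees with j1seq on [-18, 21] and at the earlier positions.
  dominationLeft dominationRight : RefutationTable
  dominationLeft =
    (18 , none , none , bound -[1+ 10 ] 16) ∷
    (19 , bound -[1+ 10 ] 16 , none , none) ∷
    (20 , none , none , bound -[1+ 10 ] 16) ∷
    (21 , bound -[1+ 10 ] 16 , bound -[1+ 10 ] 16 , none) ∷
    (22 , none , none , bound -[1+ 10 ] 16) ∷
    (23 , bound -[1+ 10 ] 16 , none , none) ∷
    (24 , none , bound -[1+ 10 ] 16 , bound -[1+ 10 ] 16) ∷
    (26 , none , bound -[1+ 10 ] 16 , bound -[1+ 10 ] 16) ∷
    (28 , none , none , bound -[1+ 10 ] 16) ∷
    (29 , bound -[1+ 10 ] 16 , none , none) ∷
    (30 , none , none , bound -[1+ 10 ] 16) ∷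
    (32 , none , bound -[1+ 10 ] 16 , bound -[1+ 10 ] 16) ∷
    (33 , bound -[1+ 10 ] 16 , none , none) ∷
    (34 , none , bound -[1+ 10 ] 16 , bound -[1+ 10 ] 16) ∷
    (35 , bound -[1+ 10 ] 16 , none , none) ∷
    (36 , none , bound -[1+ 10 ] 16 , bound -[1+ 10 ] 16) ∷
    (37 , split -[1+ 38 ] (split -[1+ 39 ] (bound -[1+ 10 ] 16) (bound -[1+ 10 ] 16) (bound -[1+ 10 ] 16))
                          (bound -[1+ 10 ] 16) (bound -[1+ 10 ] 16) ,
          none , none) ∷
    (39 , bound -[1+ 38 ] 30 , none , none) ∷
    (41 , bound -[1+ 40 ] 31 , none , none) ∷
    (42 , none , bound -[1+ 40 ] 31 , bound -[1+ 40 ] 31) ∷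
    (44 , none , none , split -[1+ 45 ] (bound -[1+ 44 ] 33) (bound -[1+ 44 ] 33) (bound -[1+ 44 ] 33)) ∷
    []
  dominationRight =
    (22 , none , none ,
          split (+ 24) (bound (+ 23) 21) (bound (+ 23) 21)
            (split (+ 25) (split (+ 26) (bound (+ 23) 21) (bound (+ 23) 21) (bound (+ 23) 21))
                          (bound (+ 23) 21) (bound (+ 23) 21))) ∷ []

  NearDominance : (ℕ → ℤ) → (ℕ → Refutations) → ℕ → Set
  NearDominance pos table i =
    Forces J1 (sampleAt j1seq pos i ++ j1Core) (pos i) (λ c → Prefers (alternate i true) c (j1seq (pos i))) (table i)

  nearDominance? : ∀ pos table i → Dec (NearDominance pos table i)
  nearDominance? pos table i = forces? J1 (sampleAt j1seq pos i ++ j1Core) (pos i)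
    (λ c → prefers? (alternate i true) c (j1seq (pos i))) (table i)

  near-left : ∀ {i} → i < 46 → NearDominance (leftPos (+ 0)) (tableAt dominationLeft) i
  near-left = toWitness {a? = ℕP.allUpTo? (nearDominance? (leftPos (+ 0)) (tableAt dominationLeft)) 46} tt

  near-right : ∀ {i} → i < 24 → NearDominance (rightPos (+ 0)) (tableAt dominationRight) i
  near-right = toWitness {a? = ℕP.allUpTo? (nearDominance? (rightPos (+ 0)) (tableAt dominationRight)) 24} tt

  side-dominated : ∀ {B} pos table c → Alphabet123 B → LBelow B J1 → Agrees B j1Core →
    (∀ {i} → i < c + 3 → NearDominance pos table i) →
    (∀ r → alternate (c + (3 + r)) true ≡ alternate r true) → (∀ s → j1seq (pos (c + s)) ≡ altern s) →
    (∀ r → B (pos (c + (3 + r))) ≡ 3 → B (pos (c + (2 + r))) ≡ 1 → B (pos (c + (1 + r))) ≡ 2 →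
           B (pos (c + r)) ≡ 1 → ⊥) →
    Dominates B j1seq pos
  side-dominated {B} pos table c alph below core near parity tail no-3 i agree = by-cases (i ℕ.<? c + 3)
    where
    by-cases : Dec (i < c + 3) → Prefers (alternate i true) (B (pos i)) (j1seq (pos i))
    by-cases (yes i<N) = forces-sound (table i) alph below (++⁺ (agreeBelow⇒agrees {C = j1seq} agree) core) (near i<N)
    by-cases (no  i≮N) =
      subst (λ i → AgreeBelow (B ∘ pos) (j1seq ∘ pos) i → Prefers (alternate i true) (B (pos i)) (j1seq (pos i)))
        (trans (sym (ℕP.+-assoc c 3 _)) (ℕP.m+[n∸m]≡n (ℕP.≮⇒≥ i≮N)))
        (ray-prefers (B ∘ pos) (j1seq ∘ pos) c (alph ∘ pos) parity tail no-3 (i ∸ (c + 3))) agree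

  j1-dominated : ∀ {B} → Alphabet123 B → LBelow B J1 → Agrees B j1Core → ∀ n → L j1seq (+ 0) n ℚ.≤ L B (+ 0) n
  j1-dominated alph below core = L-dominated (+ 0) (proj₁ ∘ alph) j1-positive (lookupK-sound core refl)
    (side-dominated (rightPos (+ 0)) (tableAt dominationRight) 21 alph below core near-right (λ _ → refl) j1-right
      λ r x₃ x₂ x₁ x₀ → no-1213 alph below (rightPos (+ 0) (24 + r)) (x₀ ∷ x₁ ∷ x₂ ∷ x₃ ∷ []))
    (side-dominated (leftPos (+ 0)) (tableAt dominationLeft) 43 alph below core near-left (λ _ → refl) j1-left
      λ r x₃ x₂ x₁ x₀ → no-3121 alph below (leftPos (+ 0) (46 + r)) (x₃ ∷ x₂ ∷ x₁ ∷ x₀ ∷ []))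

  dominated⇒¬mLt : ∀ {B} → (∀ n → L j1seq (+ 0) n ℚ.≤ L B (+ 0) n) → ¬ mLt B j1seq
  dominated⇒¬mLt {B} dominated (q , B≤q , k , n , q<L) =
    ℚP.<-irrefl-≡ refl (ℚP.<-≤-trans q<L (ℚP.≤-trans L≤L₀ (ℚP.≤-trans (dominated n′) (B≤q (+ 0) n′))))
    where
    n′ : ℕ
    n′ = proj₁ (j1-sup-at-0 k n)
    L≤L₀ : L j1seq k n ℚ.≤ L j1seq (+ 0) n′
    L≤L₀ = proj₂ (j1-sup-at-0 k n)

  mLt⇒LBelow : ∀ {B} → mLt B j1seq → LBelow B J1
  mLt⇒LBelow (q , B≤q , k , n , q<L) k′ n′ = ℚP.≤-<-trans (B≤q k′ n′) (ℚP.<-≤-trans q<L (j1-≤-J1 k n))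

  core-excluded : ∀ {B} → Alphabet123 B → mLt B j1seq → ¬ Agrees B j1Core
  core-excluded alph B<j1 core = dominated⇒¬mLt (j1-dominated alph (mLt⇒LBelow B<j1) core) B<j1

  -- Forcing the periodic extension

  Admissible : Seq → Set
  Admissible B = Alphabet123 B × mLt B j1seq

  admissible-shift : ∀ {B} s → Admissible B → Admissible (shift B s)
  admissible-shift {B} s (alph , q , B≤q , q<m) =
    alphabet-shift s alph , q , (λ k n → subst (ℚ._≤ q) (sym (L-shift B s k n)) (B≤q (k ℤ.+ s) n)) , q<m

  agrees-≗ : ∀ {B C K} → (∀ i → B i ≡ C i) → Agrees B K → Agrees C K
  agrees-≗ B≗C = All.map (trans (sym (B≗C _)))

  -- 21 w w* 11122 and 21 w w* w 11122, both starting at -18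
  windowWord extendedWord : List ℕ
  windowWord   = 2 ∷ 1 ∷ w ++ w ++ u11122
  extendedWord = 2 ∷ 1 ∷ w ++ w ++ w ++ u11122

  Window : Seq → Set
  Window B = Agrees B (wordAt -[1+ 17 ] windowWord)

  initialForcings rightForcings leftForcings : List Forcing
  initialForcings =
    (-[1+ 10 ] , 3 , split (+ 11) (bound (+ 0) 6) (bound (+ 0) 6) (bound (+ 0) 6) ,
                     split (+ 11) (bound (+ 0) 6) (bound (+ 0) 6) (split (+ 12) (bound (+ 11) 11) (bound (+ 0) 6) (bound (+ 0) 6)) ,
                     none) ∷
    (-[1+ 11 ] , 2 , bound -[1+ 10 ] 11 ,
                     none ,
                     split (+ 11) (bound (+ 0) 6) (bound (+ 0) 6) (split (+ 12) (bound (+ 11) 12) (bound (+ 0) 6) (bound (+ 0) 6))) ∷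
    (-[1+ 12 ] , 2 , split (+ 11) (bound (+ 0) 7) (bound (+ 0) 7)
                       (split (+ 12) (bound (+ 11) 12) (split (+ 13) (bound (+ 0) 7) (bound (+ 0) 7) (bound (+ 11) 12)) (bound (+ 0) 7)) ,
                     none ,
                     bound -[1+ 10 ] 11) ∷
    (-[1+ 13 ] , 1 , none ,
                     split (+ 11) (bound (+ 0) 7) (bound (+ 0) 7)
                       (split (+ 12) (bound (+ 11) 13)
                         (split (+ 13) (bound (+ 0) 7) (split (+ 14) (bound (+ 11) 13) (bound (+ 0) 7) (bound (+ 0) 7)) (bound (+ 11) 13))
                         (bound (+ 0) 7)) ,
                     split (+ 11) (bound (+ 0) 7) (bound (+ 0) 7)
                       (split (+ 12) (bound (+ 11) 13)
                         (split (+ 13) (bound (+ 0) 7) (split (+ 14) (bound (+ 11) 13) (bound (+ 0) 7) (bound (+ 0) 7)) (bound (+ 11) 13))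
                         (bound (+ 0) 7))) ∷
    (-[1+ 14 ] , 1 , none , bound -[1+ 10 ] 11 , bound -[1+ 10 ] 11) ∷
    (-[1+ 15 ] , 1 , none ,
                     split (+ 11) (bound (+ 0) 8) (bound (+ 0) 8)
                       (split (+ 12) (bound (+ 11) 14)
                         (split (+ 13) (bound (+ 0) 8)
                           (split (+ 14) (bound (+ 11) 14) (split (+ 15) (bound (+ 0) 8) (bound (+ 0) 8) (bound (+ 11) 14)) (bound (+ 0) 8))
                           (bound (+ 11) 14))
                         (bound (+ 0) 8)) ,
                     split -[1+ 16 ] (bound -[1+ 15 ] 13) (bound -[1+ 15 ] 13) (bound -[1+ 15 ] 13)) ∷
    (-[1+ 16 ] , 1 , none , bound -[1+ 10 ] 11 , bound -[1+ 10 ] 11) ∷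
    (-[1+ 17 ] , 2 , bound -[1+ 10 ] 11 , none , split -[1+ 18 ] (bound -[1+ 17 ] 14) (bound -[1+ 17 ] 14) (bound -[1+ 17 ] 14)) ∷
    []
  rightForcings =
    (+ 11 , 3 , bound (+ 0) 9 , bound (+ 0) 9 , none) ∷
    (+ 12 , 2 , bound (+ 11) 15 , none , bound (+ 0) 9) ∷
    (+ 13 , 2 , bound (+ 0) 9 , none , bound (+ 11) 15) ∷
    (+ 14 , 2 , bound (+ 11) 15 , none , bound (+ 0) 9) ∷
    (+ 15 , 2 , bound (+ 0) 9 , none , bound (+ 11) 15) ∷
    (+ 16 , 1 , none , bound (+ 0) 9 , bound (+ 0) 9) ∷
    (+ 17 , 1 , none , bound (+ 11) 15 , bound (+ 11) 15) ∷
    (+ 18 , 1 , none , split -[1+ 18 ] (bound (+ 0) 10) (bound (+ 0) 10) (bound -[1+ 10 ] 15) ,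
                       split (+ 19) (bound (+ 18) 18) (bound (+ 18) 18) (bound (+ 18) 18)) ∷
    (+ 19 , 1 , none , bound (+ 11) 15 , bound (+ 11) 15) ∷
    (+ 20 , 2 , bound (+ 11) 15 , none , split (+ 21) (bound (+ 20) 19) (bound (+ 20) 19) (bound (+ 20) 19)) ∷
    []
  leftForcings =
    (-[1+ 18 ] , 2 , bound (+ 0) 11 , none , bound -[1+ 10 ] 16) ∷
    (-[1+ 19 ] , 2 , bound -[1+ 10 ] 16 , none , bound (+ 0) 11) ∷
    []

  initial-window : ∀ {B} → Alphabet123 B → LBelow B J1 → MatchesAt B -[1+ 9 ] (u22221 ++ w ++ u11122) → Window B
  initial-window alph below match =
    ⊆ᴷ-agrees (toWitness {a? = wordAt -[1+ 17 ] windowWord ⊆ᴷ? learn K₀ initialForcings} tt)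
      (forcesAll-sound initialForcings alph below (matches⇒agrees -[1+ 9 ] (u22221 ++ w ++ u11122) match)
        (toWitness {a? = forcesAll? J1 K₀ initialForcings} tt))
    where
    K₀ : Knowledge
    K₀ = wordAt -[1+ 9 ] (u22221 ++ w ++ u11122)

  -- The letter at 21 is 2 because 1 would make B agree with j1 on [-18, 21].
  window-extends : ∀ {B} → Admissible B → Window B → Agrees B (wordAt -[1+ 17 ] extendedWord)
  window-extends {B} (alph , B<j1) window = by-letter (letter∈123 (alph (+ 21)))
    where
    below : LBelow B J1
    below = mLt⇒LBelow B<j1
    K : Knowledge
    K = learn (wordAt -[1+ 17 ] windowWord) rightForcings
    forced : Agrees B K
    forced = forcesAll-sound rightForcings alph below window
      (toWitness {a? = forcesAll? J1 (wordAt -[1+ 17 ] windowWord) rightForcings} tt)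
    B₂₁≤2 : B (+ 21) ≤ 2
    B₂₁≤2 = forces-sound {p = + 21} {P = _≤ 2} (none , none , bound (+ 11) 15) alph below forced
      (toWitness {a? = forces? J1 K (+ 21) (ℕ._≤? 2) (none , none , bound (+ 11) 15)} tt)
    by-letter : B (+ 21) ≡ 1 ⊎ B (+ 21) ≡ 2 ⊎ B (+ 21) ≡ 3 → Agrees B (wordAt -[1+ 17 ] extendedWord)
    by-letter (inj₁ B₂₁≡1) =
      ⊥-elim (core-excluded alph B<j1
        (⊆ᴷ-agrees (toWitness {a? = j1Core ⊆ᴷ? ((+ 21 , 1) ∷ K)} tt) (B₂₁≡1 ∷ forced)))
    by-letter (inj₂ (inj₁ B₂₁≡2)) =
      ⊆ᴷ-agrees (toWitness {a? = wordAt -[1+ 17 ] extendedWord ⊆ᴷ? ((+ 21 , 2) ∷ K)} tt) (B₂₁≡2 ∷ forced)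
    by-letter (inj₂ (inj₂ B₂₁≡3)) = ⊥-elim (ℕP.≤⇒≯ B₂₁≤2 (ℕP.≤-reflexive (sym B₂₁≡3)))

  window-step : ∀ {B} → Admissible B → Window B → Window (shift B (+ 11)) × MatchesAt B (+ 6) w
  window-step {B} admissible window =
    matches⇒agrees -[1+ 17 ] windowWord (matches-shift {B} {s = -[1+ 17 ]} {t = + 11}
      (agrees⇒matches -[1+ 6 ] windowWord
        (⊆ᴷ-agrees (toWitness {a? = wordAt -[1+ 6 ] windowWord ⊆ᴷ? K} tt) extended))) ,
    agrees⇒matches (+ 6) w (⊆ᴷ-agrees (toWitness {a? = wordAt (+ 6) w ⊆ᴷ? K} tt) extended)
    where
    K : Knowledge
    K = wordAt -[1+ 17 ] extendedWord
    extended : Agrees B K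
    extended = window-extends admissible window

  initial-prefix : ∀ {B} → Admissible B → Window B → MatchesAt B -[1+ 19 ] (u2221 ++ w ++ w)
  initial-prefix {B} admissible@(alph , B<j1) window =
    agrees⇒matches -[1+ 19 ] (u2221 ++ w ++ w)
      (⊆ᴷ-agrees (toWitness {a? = wordAt -[1+ 19 ] (u2221 ++ w ++ w) ⊆ᴷ? learn K leftForcings} tt)
        (forcesAll-sound leftForcings alph (mLt⇒LBelow B<j1) (window-extends admissible window)
          (toWitness {a? = forcesAll? J1 K leftForcings} tt)))
    where
    K : Knowledge
    K = wordAt -[1+ 17 ] extendedWord

  windows : ∀ {B} → Admissible B → Window B → ∀ j → Window (shift B (+ (11 * j)))
  windows {B} admissible window zero    = agrees-≗ (λ i → cong B (sym (ℤP.+-identityʳ i))) window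
  windows {B} admissible window (suc j) = agrees-≗ shift-shift
    (proj₁ (window-step (admissible-shift _ admissible) (windows admissible window j)))
    where
    shift-shift : ∀ i → B (i ℤ.+ + 11 ℤ.+ + (11 * j)) ≡ B (i ℤ.+ + (11 * suc j))
    shift-shift i =
      cong B (trans (ℤP.+-assoc i (+ 11) (+ (11 * j))) (cong (λ m → i ℤ.+ + m) (sym (ℕP.*-suc 11 j))))

  w-repeats : ∀ {B} → Admissible B → Window B →
    ∀ j t → t < 11 → B (+ 6 ℤ.+ + 11 ℤ.* + j ℤ.+ + t) ≡ nth w t
  w-repeats {B} admissible window j t t<11 =
    trans (cong B (trans (cong (λ m → + 6 ℤ.+ m ℤ.+ + t) (sym (ℤP.pos-* 11 j)))
                         (xy∙z≈xz∙y (+ 6) (+ (11 * j)) (+ t))))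
      (proj₂ (window-step (admissible-shift _ admissible) (windows admissible window j)) t t<11)

open import Data.Nat using (ℕ; _<_)
open import Data.Integer using (ℤ; +_; -[1+_]; _+_; _*_)
open import Data.List using (_++_)
open import Data.Product using (_×_; _,_)
open import Relation.Binary.PropositionalEquality using (_≡_)

mainTheorem10 : (B : Seq) → Alphabet123 B
    → MatchesAt B -[1+ 9 ] (u22221 ++ w ++ u11122)
    → mLt B j1seq
    → MatchesAt B -[1+ 19 ] (u2221 ++ w ++ w)
      × (∀ (j t : ℕ) → t < 11 → B (+ 6 + + 11 * + j + + t) ≡ nth w t)
mainTheorem10 B alph match B<j1 = initial-prefix admissible window₀ , w-repeats admissible window₀
  where
  admissible : Admissible B
  admissible = alph , B<j1
  window₀ : Window B
  window₀ = initial-window alph (mLt⇒LBelow B<j1) match
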